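{- Let $(P_n)_{n\ge0}$ be the Padovan sequence and, for $1\le b\le 3$ and $m\ge 0$, let $r_m^{(3,b)}=\sum_{k=0}^{m}P_{3k+b}$. Then for every $b\in\{1,2,3\}$ and every $m\ge 3$, $$r_m^{(3,b)}=3r_{m-1}^{(3,b)}-2r_{m-2}^{(3,b)}+r_{m-3}^{(3,b)}+1.$$
   Context: The Padovan numbers are defined by $P_0=P_1=P_2=1$ and $P_{n+3}=P_{n+1}+P_n$ for $n\ge 0$. -}

module Defs where

open import Data.Nat using (ℕ; zero; suc; _+_; _*_)

P : ℕ → ℕ
P 0 = 1
P 1 = 1
P 2 = 1
P (suc (suc (suc n))) = P (suc n) + P n

r : ℕ → ℕ → ℕ
r b zero = P b
r b (suc m) = r b m + P (3 * suc m + b)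

-- The trisected sequences n ↦ P (3n + b) satisfy u (k+3) = 3 u (k+2) − 2 u (k+1) + u k, since the cube
-- of a root of x³ − x − 1 is a root of y³ − 3y² + 2y − 1.  Summing this recurrence, the partial sums
-- satisfy the same recurrence up to a constant defect, which the first four sums show to be 1.
module Submission where

open import Defs
open import Data.Nat using (ℕ; zero; suc; _≤_; _+_; s≤s)
import Data.Nat as ℕ
open import Data.Integer using (+_; _-_; _*_) renaming (_+_ to _+ℤ_)
open import Data.Integer.Properties using (pos-*)
open import Data.List using (_∷_; [])
import Data.Nat.Tactic.RingSolver as ℕ-Solver
import Data.Integer.Tactic.RingSolver as ℤ-Solver
open import Relation.Binary.PropositionalEquality using (_≡_; refl; cong; cong₂; sym; trans; module ≡-Reasoning)

-- The recurrences are stated with the negative terms moved across, so that they live in ℕ.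
padovanLike⇒trisected : (f : ℕ → ℕ) → (∀ n → f (3 + n) ≡ f (1 + n) + f n) →
  ∀ n → f (9 + n) + 2 ℕ.* f (3 + n) ≡ 3 ℕ.* f (6 + n) + f n
padovanLike⇒trisected f rec n = begin
  f (9 + n) + 2 ℕ.* f (3 + n)
    ≡⟨ cong₂ (λ x y → x + 2 ℕ.* y) f₉ f₃ ⟩
  (((b + a) + c + (c + b)) + ((c + b) + (b + a))) + 2 ℕ.* (b + a)
    ≡⟨ regroup a b c ⟩
  3 ℕ.* ((c + b) + (b + a)) + a
    ≡⟨ cong (λ x → 3 ℕ.* x + a) (sym f₆) ⟩
  3 ℕ.* f (6 + n) + a ∎
  where
  open ≡-Reasoning
  regroup : ∀ a b c →
    (((b + a) + c + (c + b)) + ((c + b) + (b + a))) + 2 ℕ.* (b + a) ≡ 3 ℕ.* ((c + b) + (b + a)) + a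
  regroup = ℕ-Solver.solve-∀
  a = f n
  b = f (1 + n)
  c = f (2 + n)
  f₃ : f (3 + n) ≡ b + a
  f₃ = rec n
  f₄ : f (4 + n) ≡ c + b
  f₄ = rec (1 + n)
  f₅ : f (5 + n) ≡ (b + a) + c
  f₅ = trans (rec (2 + n)) (cong (_+ c) f₃)
  f₆ : f (6 + n) ≡ (c + b) + (b + a)
  f₆ = trans (rec (3 + n)) (cong₂ _+_ f₄ f₃)
  f₇ : f (7 + n) ≡ (b + a) + c + (c + b)
  f₇ = trans (rec (4 + n)) (cong₂ _+_ f₅ f₄)
  f₉ : f (9 + n) ≡ ((b + a) + c + (c + b)) + ((c + b) + (b + a))
  f₉ = trans (rec (6 + n)) (cong₂ _+_ f₇ f₆)

P-trisected : (b k : ℕ) →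
  P (3 ℕ.* (3 + k) + b) + 2 ℕ.* P (3 ℕ.* (1 + k) + b) ≡ 3 ℕ.* P (3 ℕ.* (2 + k) + b) + P (3 ℕ.* k + b)
P-trisected b k = begin
  P (3 ℕ.* (3 + k) + b) + 2 ℕ.* P (3 ℕ.* (1 + k) + b)
    ≡⟨ cong₂ (λ x y → P x + 2 ℕ.* P y) (index 3) (index 1) ⟩
  P (9 + n) + 2 ℕ.* P (3 + n)
    ≡⟨ padovanLike⇒trisected P (λ _ → refl) n ⟩
  3 ℕ.* P (6 + n) + P n
    ≡⟨ cong (λ x → 3 ℕ.* P x + P n) (sym (index 2)) ⟩
  3 ℕ.* P (3 ℕ.* (2 + k) + b) + P n ∎
  where
  open ≡-Reasoning
  n = 3 ℕ.* k + b
  index : ∀ j → 3 ℕ.* (j + k) + b ≡ 3 ℕ.* j + (3 ℕ.* k + b)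
  index j = ℕ-Solver.solve (j ∷ k ∷ b ∷ [])

partialSums-recurrence : (u S : ℕ → ℕ) (c : ℕ) →
  (∀ m → S (suc m) ≡ S m + u (suc m)) →
  (∀ k → u (3 + k) + 2 ℕ.* u (1 + k) ≡ 3 ℕ.* u (2 + k) + u k) →
  S 3 + 2 ℕ.* S 1 ≡ 3 ℕ.* S 2 + S 0 + c →
  ∀ m → S (3 + m) + 2 ℕ.* S (1 + m) ≡ 3 ℕ.* S (2 + m) + S m + c
partialSums-recurrence u S c step rec base zero = base
partialSums-recurrence u S c step rec base (suc m) = begin
  S (4 + m) + 2 ℕ.* S (2 + m)
    ≡⟨ cong₂ (λ x y → x + 2 ℕ.* y) (step (3 + m)) (step (1 + m)) ⟩
  (S (3 + m) + u (4 + m)) + 2 ℕ.* (S (1 + m) + u (2 + m))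
    ≡⟨ interchange (S (3 + m)) (S (1 + m)) (u (4 + m)) (u (2 + m)) ⟩
  (S (3 + m) + 2 ℕ.* S (1 + m)) + (u (4 + m) + 2 ℕ.* u (2 + m))
    ≡⟨ cong₂ _+_ (partialSums-recurrence u S c step rec base m) (rec (1 + m)) ⟩
  (3 ℕ.* S (2 + m) + S m + c) + (3 ℕ.* u (3 + m) + u (1 + m))
    ≡⟨ regroup (S (2 + m)) (S m) (u (3 + m)) (u (1 + m)) ⟩
  3 ℕ.* (S (2 + m) + u (3 + m)) + (S m + u (1 + m)) + c
    ≡⟨ cong₂ (λ x y → 3 ℕ.* x + y + c) (sym (step (2 + m))) (sym (step m)) ⟩
  3 ℕ.* S (3 + m) + S (1 + m) + c ∎
  where
  open ≡-Reasoning
  interchange : ∀ s t x y → (s + x) + 2 ℕ.* (t + y) ≡ (s + 2 ℕ.* t) + (x + 2 ℕ.* y)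
  interchange = ℕ-Solver.solve-∀
  regroup : ∀ s t x y → (3 ℕ.* s + t + c) + (3 ℕ.* x + y) ≡ 3 ℕ.* (s + x) + (t + y) + c
  regroup s t x y = ℕ-Solver.solve (s ∷ t ∷ c ∷ x ∷ y ∷ [])

r-recurrenceℕ : (b : ℕ) → 1 ≤ b → b ≤ 3 → (m : ℕ) →
  r b (3 + m) + 2 ℕ.* r b (1 + m) ≡ 3 ℕ.* r b (2 + m) + r b m + 1
r-recurrenceℕ b 1≤b b≤3 =
  partialSums-recurrence (λ k → P (3 ℕ.* k + b)) (r b) 1 (λ _ → refl) (P-trisected b) (base b 1≤b b≤3)
  where
  base : (b : ℕ) → 1 ≤ b → b ≤ 3 → r b 3 + 2 ℕ.* r b 1 ≡ 3 ℕ.* r b 2 + r b 0 + 1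
  base 1 _ _ = refl
  base 2 _ _ = refl
  base 3 _ _ = refl
  base (suc (suc (suc (suc _)))) _ (s≤s (s≤s (s≤s ())))

subtract-in-ℤ : (x y z w : ℕ) → x + 2 ℕ.* y ≡ 3 ℕ.* z + w + 1 →
  + x ≡ (+ 3 * + z - + 2 * + y) +ℤ + w +ℤ + 1
subtract-in-ℤ x y z w eq = begin
  + x
    ≡⟨ add-sub (+ x) (+ 2 * + y) ⟩
  (+ x +ℤ + 2 * + y) - + 2 * + y
    ≡⟨ cong (_- + 2 * + y) lifted ⟩
  (+ 3 * + z +ℤ + w +ℤ + 1) - + 2 * + y
    ≡⟨ sub-regroup (+ 3 * + z) (+ w) (+ 2 * + y) ⟩
  (+ 3 * + z - + 2 * + y) +ℤ + w +ℤ + 1 ∎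
  where
  open ≡-Reasoning
  add-sub : ∀ p q → p ≡ (p +ℤ q) - q
  add-sub = ℤ-Solver.solve-∀
  sub-regroup : ∀ p q s → (p +ℤ q +ℤ + 1) - s ≡ (p - s) +ℤ q +ℤ + 1
  sub-regroup = ℤ-Solver.solve-∀
  lifted : + x +ℤ + 2 * + y ≡ + 3 * + z +ℤ + w +ℤ + 1
  lifted = begin
    + x +ℤ + 2 * + y      ≡⟨ cong (+ x +ℤ_) (sym (pos-* 2 y)) ⟩
    + (x + 2 ℕ.* y)       ≡⟨ cong +_ eq ⟩
    + (3 ℕ.* z + w + 1)   ≡⟨ cong (λ t → t +ℤ + w +ℤ + 1) (pos-* 3 z) ⟩
    + 3 * + z +ℤ + w +ℤ + 1 ∎

mainTheorem9 : (b : ℕ) → 1 ≤ b → b ≤ 3 → (m : ℕ) →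
    + r b (3 + m) ≡ (+ 3 * + r b (2 + m) - + 2 * + r b (1 + m)) +ℤ + r b m +ℤ + 1
mainTheorem9 b 1≤b b≤3 m =
  subtract-in-ℤ (r b (3 + m)) (r b (1 + m)) (r b (2 + m)) (r b m) (r-recurrenceℕ b 1≤b b≤3 m)
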